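{- Let $H$ be a Heyting algebra. The term $x\#y:=(x\wedge\neg y)\vee(\neg x\wedge y)$ is an apartness term in $H$ if and only if $H$ is a Boolean algebra.
   Context: A Heyting algebra is a bounded distributive lattice $\langle H,\wedge,\vee,\rightarrow,\bot,\top\rangle$ in which $a\rightarrow b$ is the largest $c$ with $a\wedge c\le b$; write $\neg a$ for $a\rightarrow\bot$. A term $x\# y$ in two free variables is an apartness term in $H$ if for all $x,y,z\in H$: $x\#x=\bot$; $x\#y=y\#x$; $x\#y\le (x\#z)\vee(z\#y)$. -}

module Defs where

open import Level using (Level)
open import Data.Product using (Σ; _×_)
open import Relation.Binary.Lattice.Bundles using (HeytingAlgebra)

module _ {c ℓ₁ ℓ₂ : Level} (H : HeytingAlgebra c ℓ₁ ℓ₂) where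
  open HeytingAlgebra H

  ¬H : Carrier → Carrier
  ¬H a = a ⇨ ⊥

  symDiff : Carrier → Carrier → Carrier
  symDiff x y = (x ∧ ¬H y) ∨ (¬H x ∧ y)

  IsApartnessTerm : (Carrier → Carrier → Carrier) → Set (c Level.⊔ ℓ₁ Level.⊔ ℓ₂)
  IsApartnessTerm _#_ =
    (∀ x → (x # x) ≈ ⊥) ×
    (∀ x y → (x # y) ≈ (y # x)) ×
    (∀ x y z → (x # y) ≤ ((x # z) ∨ (z # y)))

  IsBoolean : Set (c Level.⊔ ℓ₁)
  IsBoolean = ∀ x → Σ Carrier (λ y → ((x ∧ y) ≈ ⊥) × ((x ∨ y) ≈ ⊤))

{-# OPTIONS --safe #-}
-- Both directions go through excluded middle ⊤ ≤ z ∨ ¬ z.  Cotransitivity at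
-- (⊥, ⊤, z) gives it, because ⊥ # ⊤ = ⊤, ⊥ # z ≤ z and z # ⊤ ≤ ¬ z; conversely,
-- with excluded middle every inclusion can be checked separately below z and
-- below ¬ z, where the cotransitivity of # is immediate.
module Submission where

open import Defs
open import Level using (Level)
open import Data.Product using (_×_; _,_)
open import Relation.Binary.Lattice.Bundles using (HeytingAlgebra)
import Relation.Binary.Lattice.Properties.HeytingAlgebra as HeytingAlgebraProperties
import Relation.Binary.Lattice.Properties.MeetSemilattice as MeetSemilatticeProperties
import Relation.Binary.Lattice.Properties.JoinSemilattice as JoinSemilatticeProperties
import Relation.Binary.Reasoning.PartialOrder as ≤-Reasoning

module _ {c ℓ₁ ℓ₂ : Level} (H : HeytingAlgebra c ℓ₁ ℓ₂) where
  open HeytingAlgebra H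
  open HeytingAlgebraProperties H using (¬_; ⇨-eval; ⇨-applyʳ; swap-transpose-⇨; ∧-distribˡ-∨-≤)
  open MeetSemilatticeProperties meetSemilattice using (∧-comm; ∧-monotonic)
  open JoinSemilatticeProperties joinSemilattice using (∨-comm; ∨-cong; ∨-monotonic)
  open ≤-Reasoning poset

  private
    _#_ : Carrier → Carrier → Carrier
    _#_ = symDiff H

  ExcludedMiddle : Set (c Level.⊔ ℓ₂)
  ExcludedMiddle = ∀ x → ⊤ ≤ x ∨ ¬ x

  isBoolean⇒excludedMiddle : IsBoolean H → ExcludedMiddle
  isBoolean⇒excludedMiddle boolean x with boolean x
  ... | y , x∧y≈⊥ , x∨y≈⊤ = begin
    ⊤     ≈⟨ Eq.sym x∨y≈⊤ ⟩
    x ∨ y ≤⟨ ∨-monotonic refl (swap-transpose-⇨ (reflexive x∧y≈⊥)) ⟩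
    x ∨ ¬ x ∎

  excludedMiddle⇒isBoolean : ExcludedMiddle → IsBoolean H
  excludedMiddle⇒isBoolean lem x =
    ¬ x , antisym (⇨-applyʳ refl) (minimum _) , antisym (maximum _) (lem x)

  ≤-by-cases : ∀ {u v a t} → ⊤ ≤ u ∨ v → a ∧ u ≤ t → a ∧ v ≤ t → a ≤ t
  ≤-by-cases {u} {v} {a} {t} ⊤≤u∨v a∧u≤t a∧v≤t = begin
    a               ≤⟨ ∧-greatest refl (trans (maximum a) ⊤≤u∨v) ⟩
    a ∧ (u ∨ v)     ≤⟨ ∧-distribˡ-∨-≤ a u v ⟩
    a ∧ u ∨ a ∧ v   ≤⟨ ∨-least a∧u≤t a∧v≤t ⟩
    t               ∎

  #-irrefl : ∀ x → x # x ≈ ⊥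
  #-irrefl x = antisym (∨-least (⇨-applyʳ refl) ⇨-eval) (minimum _)

  #-sym : ∀ x y → x # y ≈ y # x
  #-sym x y = Eq.trans (∨-comm _ _) (∨-cong (∧-comm _ _) (∧-comm _ _))

  ⊤≤⊥#⊤ : ⊤ ≤ ⊥ # ⊤
  ⊤≤⊥#⊤ = trans (∧-greatest (swap-transpose-⇨ (x∧y≤x _ _)) refl) (y≤x∨y _ _)

  ⊥#x≤x : ∀ x → ⊥ # x ≤ x
  ⊥#x≤x x = ∨-least (trans (x∧y≤x _ _) (minimum x)) (x∧y≤y _ _)

  x#⊤≤¬x : ∀ x → x # ⊤ ≤ ¬ x
  x#⊤≤¬x x = ∨-least (trans (⇨-applyʳ (maximum x)) (minimum _)) (x∧y≤x _ _)

  cotransitive⇒excludedMiddle : (∀ x y z → x # y ≤ (x # z) ∨ (z # y)) → ExcludedMiddle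
  cotransitive⇒excludedMiddle cotrans x = begin
    ⊤                 ≤⟨ ⊤≤⊥#⊤ ⟩
    ⊥ # ⊤             ≤⟨ cotrans ⊥ ⊤ x ⟩
    (⊥ # x) ∨ (x # ⊤) ≤⟨ ∨-monotonic (⊥#x≤x x) (x#⊤≤¬x x) ⟩
    x ∨ ¬ x           ∎

  excludedMiddle⇒cotransitive : ExcludedMiddle → ∀ x y z → x # y ≤ (x # z) ∨ (z # y)
  excludedMiddle⇒cotransitive lem x y z = ∨-least
    (≤-by-cases (lem z) (trans drop-middle (into-z#y (x≤x∨y _ _)))
                        (trans drop-second (into-x#z (x≤x∨y _ _))))
    (≤-by-cases (lem z) (trans drop-second (into-x#z (y≤x∨y _ _)))
                        (trans drop-middle (into-z#y (y≤x∨y _ _))))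
    where
    drop-second : ∀ {a b c} → (a ∧ b) ∧ c ≤ a ∧ c
    drop-second = ∧-monotonic (x∧y≤x _ _) refl

    drop-middle : ∀ {a b c} → (a ∧ b) ∧ c ≤ c ∧ b
    drop-middle = ∧-greatest (x∧y≤y _ _) (trans (x∧y≤x _ _) (x∧y≤y _ _))

    into-x#z : ∀ {a} → a ≤ x # z → a ≤ (x # z) ∨ (z # y)
    into-x#z a≤x#z = trans a≤x#z (x≤x∨y _ _)

    into-z#y : ∀ {a} → a ≤ z # y → a ≤ (x # z) ∨ (z # y)
    into-z#y a≤z#y = trans a≤z#y (y≤x∨y _ _)

  isApartnessTerm⇒isBoolean : IsApartnessTerm H _#_ → IsBoolean H
  isApartnessTerm⇒isBoolean (_ , _ , cotrans) =
    excludedMiddle⇒isBoolean (cotransitive⇒excludedMiddle cotrans)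

  isBoolean⇒isApartnessTerm : IsBoolean H → IsApartnessTerm H _#_
  isBoolean⇒isApartnessTerm boolean =
    #-irrefl , #-sym , excludedMiddle⇒cotransitive (isBoolean⇒excludedMiddle boolean)

mainTheorem5 : {c ℓ₁ ℓ₂ : Level} (H : HeytingAlgebra c ℓ₁ ℓ₂) →
    (IsApartnessTerm H (symDiff H) → IsBoolean H) × (IsBoolean H → IsApartnessTerm H (symDiff H))
mainTheorem5 H = isApartnessTerm⇒isBoolean H , isBoolean⇒isApartnessTerm H
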